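{- Let $G$ be a finite simple connected graph such that the relation $\sim_G$ on $V(G)$ has at most three equivalence classes. Then $G$ is $A$-vertex magic for every Abelian group $A$ with $|A|>2$.
   Context: For a non-trivial Abelian group $A$, a graph $G$ is $A$-vertex magic if there exist a labeling $l : V(G) \to A\setminus\{0\}$ and $\mu \in A$ such that $\sum_{u \in N_G(v)} l(u) = \mu$ for every $v \in V(G)$, where $N_G(v)$ is the open neighborhood of $v$. The relation $\sim_G$ is defined by $u \sim_G v$ iff $N_G(u)=N_G(v)$. -}

module Defs where

open import Level using (Level; _⊔_)
open import Data.Nat using (ℕ; _≤_)
open import Data.Fin using (Fin)
open import Data.Bool using (Bool; true; false; if_then_else_)
open import Data.Product using (Σ; ∃; _×_; _,_)
open import Relation.Binary.PropositionalEquality using (_≡_)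
open import Relation.Nullary using (¬_)
open import Algebra.Bundles using (AbelianGroup)
import Algebra.Definitions.RawMonoid as RM

record SimpleGraph (n : ℕ) : Set where
  field
    adj     : Fin n → Fin n → Bool
    symm    : ∀ u v → adj u v ≡ adj v u
    irrefl  : ∀ v → adj v v ≡ false
open SimpleGraph public

data Reachable {n : ℕ} (G : SimpleGraph n) : Fin n → Fin n → Set where
  here  : ∀ {v} → Reachable G v v
  step  : ∀ {u w v} → adj G u w ≡ true → Reachable G w v → Reachable G u v

Connected : ∀ {n} → SimpleGraph n → Set
Connected G = ∀ u v → Reachable G u v

SameNbhd : ∀ {n} → SimpleGraph n → Fin n → Fin n → Set
SameNbhd G u v = ∀ w → adj G u w ≡ adj G v w

AtMostClasses : ∀ {n} → SimpleGraph n → ℕ → Set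
AtMostClasses {n} G k =
  Σ ℕ λ m → m ≤ k × Σ (Fin m → Fin n) λ r → ∀ v → ∃ λ i → SameNbhd G v (r i)

MoreThanTwo : ∀ {c ℓ} → AbelianGroup c ℓ → Set (c ⊔ ℓ)
MoreThanTwo A = let open AbelianGroup A in
  Σ Carrier λ a → Σ Carrier λ b → Σ Carrier λ c →
    ¬ (a ≈ b) × ¬ (a ≈ c) × ¬ (b ≈ c)

VertexMagic : ∀ {c ℓ} (A : AbelianGroup c ℓ) {n} → SimpleGraph n → Set (c ⊔ ℓ)
VertexMagic A {n} G = let open AbelianGroup A; open RM rawMonoid using (sum) in
  Σ (Fin n → Carrier) λ l → Σ Carrier λ μ →
    (∀ v → ¬ (l v ≈ ε)) ×
    (∀ v → sum (λ u → if adj G v u then l u else ε) ≈ μ)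

-- If u and v are nonadjacent but some w is adjacent to u and not to v, then
-- connectivity gives v a neighbour z, and z, u, w, v are pairwise non-twins:
-- four ~-classes.  So with at most three classes, nonadjacent vertices are
-- twins, i.e. G is complete multipartite with the ~-classes as its parts, and
-- N(v) is everything outside the class of v.  It then suffices to label the
-- vertices by nonzero elements so that every class has the same sum g.  For
-- three distinct a, b, c put g = a − b and x = a − c, so that g, x and g − x
-- are nonzero; along a class use x, −x, x, −x, … and give the last member
-- g or g − x, whichever completes the sum to g.
module Submission where

open import Level using (Level)
open import Data.Bool using (Bool; true; false; not; if_then_else_)
open import Data.Bool.Properties using (if-not; not-involutive)
open import Data.Empty using (⊥; ⊥-elim)
open import Data.Fin using (Fin; zero; suc; _<_)
open import Data.Fin.Properties using (pigeonhole)
open import Data.Fin.Subset using (Subset; Nonempty; Empty)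
open import Data.Fin.Subset.Properties using (nonempty?; drop-∷-Empty)
open import Data.Nat using (ℕ; suc; s≤s)
open import Data.Product using (Σ; _×_; _,_; proj₁; proj₂)
open import Data.Vec using (Vec; []; _∷_; here; there; lookup; tabulate)
open import Data.Vec.Properties using (lookup∘tabulate; tabulate-cong; lookup⇒[]=)
open import Function using (_∘_)
open import Relation.Binary.PropositionalEquality as ≡ using (_≡_)
open import Relation.Nullary using (¬_; yes; no; does; contradiction)
open import Algebra.Bundles using (AbelianGroup; Group)
import Algebra.Properties.AbelianGroup as AbelianGroupProperties
import Algebra.Properties.CommutativeMonoid.Sum as Sum
import Relation.Binary.Reasoning.Setoid as SetoidReasoning

open import Defs

module _ {c ℓ} (A : AbelianGroup c ℓ) where
  open AbelianGroup A
  open AbelianGroupProperties A using (xyx⁻¹≈y; x∙y⁻¹≈ε⇒x≈y; ⁻¹-injective; ε⁻¹≈ε)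
  open Sum commutativeMonoid using (sum; sum-cong-≋; sum-cong-≗; ∑-distrib-+)
  open SetoidReasoning setoid

  sumOver : ∀ {n} → Subset n → (Fin n → Carrier) → Carrier
  sumOver p f = sum (λ u → if lookup p u then f u else ε)

  sumOver-Empty : ∀ {n} {p : Subset n} (f : Fin n → Carrier) → Empty p → sumOver p f ≈ ε
  sumOver-Empty {p = []}        f _ = refl
  sumOver-Empty {p = true ∷ p}  f e = contradiction (zero , here) e
  sumOver-Empty {p = false ∷ p} f e =
    trans (identityˡ _) (sumOver-Empty (f ∘ suc) (drop-∷-Empty e))

  sum-split : ∀ {n} (p : Subset n) (f : Fin n → Carrier) →
              sum (λ u → if lookup p u then ε else f u) ∙ sumOver p f ≈ sum f
  sum-split p f = begin
    sum outside ∙ sum inside          ≈⟨ ∑-distrib-+ outside inside ⟨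
    sum (λ u → outside u ∙ inside u)  ≈⟨ sum-cong-≋ (λ u → complementary (lookup p u)) ⟩
    sum f                             ∎
    where
    outside inside : Fin _ → Carrier
    outside u = if lookup p u then ε else f u
    inside u = if lookup p u then f u else ε

    complementary : ∀ {y} b → (if b then ε else y) ∙ (if b then y else ε) ≈ y
    complementary true  = identityˡ _
    complementary false = identityʳ _

  module _ (g x : Carrier) (g≉ε : g ≉ ε) (x≉ε : x ≉ ε) (g≉x : g ≉ x) where

    -- The flag records whether the members labelled so far sum to x (true)
    -- or to ε (false); `remaining` is what the rest of the class must add.
    remaining : Bool → Carrier
    remaining false = g
    remaining true  = g ∙ x ⁻¹

    stride : Bool → Carrier
    stride false = x
    stride true  = x ⁻¹

    remaining≉ε : ∀ π → remaining π ≉ ε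
    remaining≉ε false = g≉ε
    remaining≉ε true  = g≉x ∘ x∙y⁻¹≈ε⇒x≈y g x

    stride≉ε : ∀ π → stride π ≉ ε
    stride≉ε false = x≉ε
    stride≉ε true x⁻¹≈ε = x≉ε (⁻¹-injective (trans x⁻¹≈ε (sym ε⁻¹≈ε)))

    stride∙remaining : ∀ π → stride π ∙ remaining (not π) ≈ remaining π
    stride∙remaining false = trans (sym (assoc x g (x ⁻¹))) (xyx⁻¹≈y x g)
    stride∙remaining true  = comm (x ⁻¹) g

    label : ∀ {n} → Bool → Subset n → Fin n → Carrier
    label π (_ ∷ p) zero    = if does (nonempty? p) then stride π else remaining π
    label π (b ∷ p) (suc u) = label (if b then not π else π) p u

    label≉ε : ∀ {n} π (p : Subset n) u → label π p u ≉ ε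
    label≉ε π (_ ∷ p) zero with nonempty? p
    ... | yes _ = stride≉ε π
    ... | no _  = remaining≉ε π
    label≉ε π (_ ∷ p) (suc u) = label≉ε _ p u

    sumOver-label : ∀ {n} π (p : Subset n) → Nonempty p → sumOver p (label π p) ≈ remaining π
    sumOver-label π (true ∷ p) _ with nonempty? p
    ... | yes p≠∅ = trans (∙-congˡ (sumOver-label (not π) p p≠∅)) (stride∙remaining π)
    ... | no p≡∅  = trans (∙-congˡ (sumOver-Empty _ p≡∅)) (identityʳ _)
    sumOver-label π (false ∷ p) (suc u , there u∈p) =
      trans (identityˡ _) (sumOver-label π p (u , u∈p))

    partitionLabelling : ∀ {n} (cls : Fin n → Subset n) →
      (∀ v → lookup (cls v) v ≡ true) →
      (∀ u v → lookup (cls v) u ≡ true → cls u ≡ cls v) →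
      Σ (Fin n → Carrier) λ l → (∀ u → l u ≉ ε) × (∀ v → sumOver (cls v) l ≈ g)
    partitionLabelling cls self∈cls cls-cong =
      l , (λ u → label≉ε false (cls u) u) , classSum
      where
      l : Fin _ → Carrier
      l u = label false (cls u) u

      classSum : ∀ v → sumOver (cls v) l ≈ g
      classSum v = begin
        sumOver (cls v) l                       ≡⟨ sum-cong-≗ agree ⟩
        sumOver (cls v) (label false (cls v))   ≈⟨ sumOver-label false (cls v) v∈cls ⟩
        g                                       ∎
        where
        v∈cls : Nonempty (cls v)
        v∈cls = v , lookup⇒[]= v (cls v) (self∈cls v)

        agree : ∀ u → (if lookup (cls v) u then l u else ε)
                    ≡ (if lookup (cls v) u then label false (cls v) u else ε)
        agree u with lookup (cls v) u in u∈cls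
        ... | true  = ≡.cong (λ p → label false p u) (cls-cong u v u∈cls)
        ... | false = ≡.refl

module _ {n} (G : SimpleGraph n) where
  open ≡ using (refl; sym; trans; cong)

  CompleteMultipartite : Set
  CompleteMultipartite = ∀ u v → adj G u v ≡ false → SameNbhd G u v

  distinguishes : ∀ {a b w} → adj G a w ≡ true → adj G b w ≡ false → ¬ SameNbhd G a b
  distinguishes {w = w} aw bw same = contradiction (trans (sym aw) (trans (same w) bw)) λ ()

  noPairwiseNonTwins : ∀ {k} → AtMostClasses G k → (f : Fin (suc k) → Fin n) →
                       (∀ {i j} → i < j → ¬ SameNbhd G (f i) (f j)) → ⊥
  noPairwiseNonTwins (m , m≤k , rep , classOf) f nonTwins
    with pigeonhole (s≤s m≤k) (proj₁ ∘ classOf ∘ f)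
  ... | i , j , i<j , sameClass = nonTwins i<j λ w →
    trans (proj₂ (classOf (f i)) w)
          (trans (cong (λ r → adj G (rep r) w) sameClass) (sym (proj₂ (classOf (f j)) w)))

  noDistinguishingVertex : Connected G → AtMostClasses G 3 → ∀ {u v w} →
    adj G u v ≡ false → adj G u w ≡ true → adj G v w ≡ false → ⊥
  noDistinguishingVertex connected threeClasses {u} {v} {w} uv uw vw with connected v u
  ... | here = contradiction (trans (sym uw) vw) λ ()
  ... | step {w = z} vz _ = noPairwiseNonTwins threeClasses (lookup zuwv) nonTwins
    where
    zuwv : Vec (Fin n) 4
    zuwv = z ∷ u ∷ w ∷ v ∷ []

    zv : adj G z v ≡ true
    zv = trans (symm G z v) vz
    wu : adj G w u ≡ true
    wu = trans (symm G w u) uw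
    vu : adj G v u ≡ false
    vu = trans (symm G v u) uv
    wv : adj G w v ≡ false
    wv = trans (symm G w v) vw

    nonTwins : ∀ {i j} → i < j → ¬ SameNbhd G (lookup zuwv i) (lookup zuwv j)
    nonTwins {zero}           {suc zero}                _ = distinguishes zv uv
    nonTwins {zero}           {suc (suc zero)}          _ = distinguishes zv wv
    nonTwins {zero}           {suc (suc (suc zero))}    _ = distinguishes zv (irrefl G v)
    nonTwins {suc zero}       {suc (suc zero)}          _ = distinguishes uw (irrefl G w)
    nonTwins {suc zero}       {suc (suc (suc zero))}    _ = distinguishes uw vw
    nonTwins {suc (suc zero)} {suc (suc (suc zero))}    _ = distinguishes wu vu
    nonTwins {_}                 {zero}                 ()
    nonTwins {suc _}             {suc zero}             (s≤s ())
    nonTwins {suc (suc _)}       {suc (suc zero)}       (s≤s (s≤s ()))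
    nonTwins {suc (suc (suc _))} {suc (suc (suc zero))} (s≤s (s≤s (s≤s ())))

  threeClasses⇒completeMultipartite : Connected G → AtMostClasses G 3 → CompleteMultipartite
  threeClasses⇒completeMultipartite connected threeClasses u v uv w
    with adj G u w in uw | adj G v w in vw
  ... | true  | true  = refl
  ... | false | false = refl
  ... | true  | false = ⊥-elim (noDistinguishingVertex connected threeClasses uv uw vw)
  ... | false | true  =
    ⊥-elim (noDistinguishingVertex connected threeClasses (trans (symm G v u) uv) vw uw)

  nonNbhd : Fin n → Subset n
  nonNbhd v = tabulate (not ∘ adj G v)

  self∈nonNbhd : ∀ v → lookup (nonNbhd v) v ≡ true
  self∈nonNbhd v = trans (lookup∘tabulate _ v) (cong not (irrefl G v))

  nonNbhd-cong : CompleteMultipartite → ∀ u v → lookup (nonNbhd v) u ≡ true → nonNbhd u ≡ nonNbhd v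
  nonNbhd-cong multipartite u v u∈v = tabulate-cong λ w → cong not (sym (multipartite v u vu w))
    where
    vu : adj G v u ≡ false
    vu = trans (sym (not-involutive _)) (cong not (trans (sym (lookup∘tabulate _ u)) u∈v))

module _ {c ℓ} (A : AbelianGroup c ℓ) {n} (G : SimpleGraph n) where
  open AbelianGroup A
  open Group group using (_//_)
  open AbelianGroupProperties A using (x∙y⁻¹≈ε⇒x≈y; x≈z//y; ∙-cancelˡ; ⁻¹-injective)
  open Sum commutativeMonoid using (sum; sum-cong-≗)
  open SetoidReasoning setoid

  equalPartSums⇒vertexMagic : (l : Fin n → Carrier) (g : Carrier) → (∀ u → l u ≉ ε) →
    (∀ v → sumOver A (nonNbhd G v) l ≈ g) → VertexMagic A G
  equalPartSums⇒vertexMagic l g l≉ε partSum =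
    l , sum l // g , l≉ε , λ v → x≈z//y _ g _ (nbhdSum∙g v)
    where
    nbhdSum∙g : ∀ v → sum (λ u → if adj G v u then l u else ε) ∙ g ≈ sum l
    nbhdSum∙g v = begin
      sum (λ u → if adj G v u then l u else ε) ∙ g
        ≡⟨ ≡.cong (_∙ g) (sum-cong-≗ outsidePart) ⟩
      sum (λ u → if lookup (nonNbhd G v) u then ε else l u) ∙ g
        ≈⟨ ∙-congˡ (partSum v) ⟨
      sum (λ u → if lookup (nonNbhd G v) u then ε else l u) ∙ sumOver A (nonNbhd G v) l
        ≈⟨ sum-split A (nonNbhd G v) l ⟩
      sum l ∎
      where
      outsidePart : ∀ u → (if adj G v u then l u else ε)
                        ≡ (if lookup (nonNbhd G v) u then ε else l u)
      outsidePart u = ≡.sym (≡.trans (≡.cong (λ b → if b then ε else l u) (lookup∘tabulate _ u))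
                                     (if-not (adj G v u)))

  completeMultipartite⇒vertexMagic : MoreThanTwo A → CompleteMultipartite G → VertexMagic A G
  completeMultipartite⇒vertexMagic (a , b , c , a≉b , a≉c , b≉c) multipartite =
    let l , l≉ε , partSum = partitionLabelling A g x g≉ε x≉ε g≉x
                              (nonNbhd G) (self∈nonNbhd G) (nonNbhd-cong G multipartite)
    in equalPartSums⇒vertexMagic l g l≉ε partSum
    where
    g x : Carrier
    g = a // b
    x = a // c

    g≉ε : g ≉ ε
    g≉ε = a≉b ∘ x∙y⁻¹≈ε⇒x≈y a b

    x≉ε : x ≉ ε
    x≉ε = a≉c ∘ x∙y⁻¹≈ε⇒x≈y a c

    g≉x : g ≉ x
    g≉x = b≉c ∘ ⁻¹-injective ∘ ∙-cancelˡ a _ _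

mainTheorem4 : (n : ℕ) (G : SimpleGraph n) → Connected G → AtMostClasses G 3 →
    ∀ {c ℓ : Level} (A : AbelianGroup c ℓ) → MoreThanTwo A → VertexMagic A G
mainTheorem4 n G connected threeClasses A moreThanTwo =
  completeMultipartite⇒vertexMagic A G moreThanTwo
    (threeClasses⇒completeMultipartite G connected threeClasses)
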